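{- Let $\mathcal{A}$ be a progressive timed MSR (PTS). In every infinite trace of $\mathcal{A}$, the global time tends to infinity.
   Context: Fix a finite first-order typed alphabet $\Sigma$. A timestamped fact is $F@t$ where $F$ is a fact (atomic formula over $\Sigma$) and $t\in\mathbb{N}$. There is a special nullary predicate $Time$. A configuration is a finite multiset of ground timestamped facts containing exactly one fact $Time@t$; $t$ is the global time. The Tick rule is $Time@T \to Time@(T+1)$: it increases the global time by one and leaves all other facts unchanged. An instantaneous rule has the form $Time@T, \mathcal{W}, F_1@T_1', \ldots, F_n@T_n' \mid \mathcal{C} \to Time@T, \mathcal{W}, Q_1@(T+D_1), \ldots, Q_m@(T+D_m)$, with $D_j\in\mathbb{N}$, $\mathcal{W}$ a multiset of timestamped facts possibly with variables, consumed facts $F_i@T_i'$, created facts $Q_j@(T+D_j)$, and guard $\mathcal{C}$ a finite set of constraints $T_a > T_b \pm N$ or $T_a = T_b \pm N$ ($T_a,T_b$ time variables of the precondition, $N\in\mathbb{N}$); $T_a\ge T_b\pm N$ abbreviates the disjunction. A rule with precondition $W$, guard $\mathcal{C}$, postcondition $W'$ applies to $\mathcal{S}$ if there is a ground substitution $\sigma$ with $W\sigma\subseteq\mathcal{S}$ (multisets) and $\mathcal{C}\sigma$ true; the result is $(\mathcal{S}\setminus W\sigma)\cup W'\sigma$. A timed MSR is a set of rules consisting of the Tick rule and instantaneous rules; a trace is a finite or infinite sequence $\mathcal{S}_0\to\mathcal{S}_1\to\cdots$ of rule applications. A timed MSR is progressive (a PTS) if every instantaneous rule satisfies: $n=m$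 (balanced); at least one $D_j\ge 1$; and the guard $\mathcal{C}$ contains $T\ge T_i'$ for every consumed fact $F_i@T_i'$. -}

module Defs where

open import Data.Nat using (ℕ; zero; suc; _+_; _≤_; _<_; _>_)
open import Data.Fin using (Fin)
open import Data.List using (List; []; _∷_; _++_; map; length)
open import Data.List.Relation.Unary.All using (All)
open import Data.List.Relation.Unary.Any using (Any)
open import Data.List.Membership.Propositional using (_∈_)
open import Data.List.Relation.Binary.Permutation.Propositional using (_↭_)
open import Data.Product using (_×_; _,_; proj₁; proj₂; ∃)
open import Data.Sum using (_⊎_)
open import Data.Empty using (⊥)
open import Relation.Binary.PropositionalEquality using (_≡_)

-- Constants are
-- nullary function symbols.  The special nullary predicate Time is NOT
-- among the ordinary predicate symbols: it is represented separately
-- (a configuration carries exactly one Time fact, i.e. a global time).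

record Alphabet : Set where
  field
    nSorts   : ℕ
    nFun     : ℕ
    funArgs  : Fin nFun → List (Fin nSorts)
    funRes   : Fin nFun → Fin nSorts
    nPred    : ℕ
    predArgs : Fin nPred → List (Fin nSorts)

module _ (𝔄 : Alphabet) where
  open Alphabet 𝔄

  Sort : Set
  Sort = Fin nSorts

  mutual
    data Term (V : Sort → Set) : Sort → Set where
      var : ∀ {s} → V s → Term V s
      app : (f : Fin nFun) → Terms V (funArgs f) → Term V (funRes f)

    data Terms (V : Sort → Set) : List Sort → Set where
      []  : Terms V []
      _∷_ : ∀ {s ss} → Term V s → Terms V ss → Terms V (s ∷ ss)

  record Fact (V : Sort → Set) : Set where
    constructor fact
    field
      pred : Fin nPred
      args : Terms V (predArgs pred)

  PVar : Sort → Set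
  PVar _ = ℕ

  NoVar : Sort → Set
  NoVar _ = ⊥

  GFact : Set
  GFact = Fact NoVar

  PFact : Set
  PFact = Fact PVar

  Subst : Set
  Subst = (s : Sort) → ℕ → Term NoVar s

  mutual
    substT : Subst → ∀ {s} → Term PVar s → Term NoVar s
    substT σ {s} (var x) = σ s x
    substT σ (app f ts) = app f (substTs σ ts)

    substTs : Subst → ∀ {ss} → Terms PVar ss → Terms NoVar ss
    substTs σ [] = []
    substTs σ (t ∷ ts) = substT σ t ∷ substTs σ ts

  substF : Subst → PFact → GFact
  substF σ (fact P as) = fact P (substTs σ as)

  -- configuration: the unique fact Time@time, plus a finite multiset
  -- (list up to permutation) of ground timestamped facts
  record Config : Set where
    constructor ⟨_,_⟩
    field
      time  : ℕ
      facts : List (GFact × ℕ)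

data TTerm : Set where
  tvar   : ℕ → TTerm
  tconst : ℕ → TTerm

TSubst : Set
TSubst = ℕ → ℕ

evalT : TSubst → TTerm → ℕ
evalT τ (tvar x)   = τ x
evalT τ (tconst n) = n

data Sign : Set where
  plus minus : Sign

-- constraints  T_a > T_b ± N,  T_a = T_b ± N,  T_a ≥ T_b ± N
-- (time variables T_a, T_b given by their names)
data Constraint : Set where
  cgt ceq cge : ℕ → ℕ → Sign → ℕ → Constraint

-- T_a > T_b - N  is read over the integers, i.e.  T_a + N > T_b
gtHolds : ℕ → ℕ → Sign → ℕ → Set
gtHolds a b plus  N = a > b + N
gtHolds a b minus N = a + N > b

eqHolds : ℕ → ℕ → Sign → ℕ → Set
eqHolds a b plus  N = a ≡ b + N
eqHolds a b minus N = a + N ≡ b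

sat : TSubst → Constraint → Set
sat τ (cgt a b sg N) = gtHolds (τ a) (τ b) sg N
sat τ (ceq a b sg N) = eqHolds (τ a) (τ b) sg N
sat τ (cge a b sg N) = gtHolds (τ a) (τ b) sg N ⊎ eqHolds (τ a) (τ b) sg N

-- Instantaneous rules
--   Time@T, W, F_1@T_1', ..., F_n@T_n' | C
--     → Time@T, W, Q_1@(T+D_1), ..., Q_m@(T+D_m)

record InstRule (𝔄 : Alphabet) : Set where
  field
    T     : ℕ
    W     : List (PFact 𝔄 × TTerm)
    F     : List (PFact 𝔄 × ℕ)         -- consumed F_i@T_i' (T_i' a time variable)
    Q     : List (PFact 𝔄 × ℕ)         -- created Q_j@(T+D_j), stores D_j
    guard : List Constraint
open InstRule public

module _ {𝔄 : Alphabet} where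

  instW : Subst 𝔄 → TSubst → List (PFact 𝔄 × TTerm) → List (GFact 𝔄 × ℕ)
  instW σ τ = map (λ p → substF 𝔄 σ (proj₁ p) , evalT τ (proj₂ p))

  instF : Subst 𝔄 → TSubst → List (PFact 𝔄 × ℕ) → List (GFact 𝔄 × ℕ)
  instF σ τ = map (λ p → substF 𝔄 σ (proj₁ p) , τ (proj₂ p))

  instQ : Subst 𝔄 → ℕ → List (PFact 𝔄 × ℕ) → List (GFact 𝔄 × ℕ)
  instQ σ t = map (λ p → substF 𝔄 σ (proj₁ p) , t + proj₂ p)

  data Step (R : InstRule 𝔄 → Set) : Config 𝔄 → Config 𝔄 → Set where
    tick : ∀ t fs → Step R ⟨ t , fs ⟩ ⟨ suc t , fs ⟩
    inst : ∀ (r : InstRule 𝔄) → R r →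
           ∀ (σ : Subst 𝔄) (τ : TSubst) (rest : List (GFact 𝔄 × ℕ))
             (t : ℕ) (fs fs' : List (GFact 𝔄 × ℕ)) →
           τ (T r) ≡ t →
           All (sat τ) (guard r) →
           fs  ↭ (instW σ τ (W r) ++ instF σ τ (F r)) ++ rest →
           fs' ↭ (instW σ τ (W r) ++ instQ σ t (Q r)) ++ rest →
           Step R ⟨ t , fs ⟩ ⟨ t , fs' ⟩

  Progressive : InstRule 𝔄 → Set
  Progressive r =
      length (F r) ≡ length (Q r)
    × Any (λ q → 1 ≤ proj₂ q) (Q r)
    × All (λ f → ∃ λ sg → cge (T r) (proj₂ f) sg 0 ∈ guard r) (F r)

  PTS : (InstRule 𝔄 → Set) → Set
  PTS R = ∀ r → R r → Progressive r

  InfTrace : (InstRule 𝔄 → Set) → (ℕ → Config 𝔄) → Set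
  InfTrace R s = ∀ i → Step R (s i) (s (suc i))

-- Count the facts of a configuration whose timestamp is not in the future
-- (timestamp ≤ global time).  An instantaneous rule of a PTS consumes n such
-- facts, since its guard forces T ≥ Tᵢ', and creates only n facts, at least
-- one of them strictly in the future, so it lowers the count without moving
-- the clock.  Hence no infinite trace can avoid Tick forever, and as time
-- never decreases it grows beyond every bound.
module Submission where

open import Defs
open import Data.Nat using (ℕ; suc; _+_; _≤_; _<_; _≤′_; ≤′-refl; ≤′-step; _≤?_; z≤n)
open import Data.Nat.Properties
open import Data.Nat.Induction using (<-wellFounded)
open import Data.Product using (∃; _,_; _×_; proj₁; proj₂)
open import Data.Sum using (_⊎_; inj₁; inj₂)
open import Data.List using (List; _++_; length; filter)
open import Data.List.Properties using (length-++; length-map; filter-++; filter-all; filter-notAll)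
open import Data.List.Relation.Unary.All as All using (All)
open import Data.List.Relation.Unary.Any as Any using (Any)
import Data.List.Relation.Unary.All.Properties as All
import Data.List.Relation.Unary.Any.Properties as Any
open import Data.List.Membership.Propositional using (_∈_)
open import Data.List.Relation.Binary.Permutation.Propositional using (_↭_)
open import Data.List.Relation.Binary.Permutation.Propositional.Properties using (filter-↭; ↭-length)
open import Induction.WellFounded using (Acc; acc)
open import Relation.Binary.PropositionalEquality using (_≡_; refl; sym; trans; cong; subst)

module _ (time μ : ℕ → ℕ)
         (lexDescends : ∀ i → time i < time (suc i) ⊎ (time (suc i) ≡ time i × μ (suc i) < μ i))
         where

  time-step-≤ : ∀ i → time i ≤ time (suc i)
  time-step-≤ i with lexDescends i
  ... | inj₁ lt       = <⇒≤ lt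
  ... | inj₂ (eq , _) = ≤-reflexive (sym eq)

  time-mono : ∀ {i j} → i ≤′ j → time i ≤ time j
  time-mono ≤′-refl           = ≤-refl
  time-mono (≤′-step {j} i≤j) = ≤-trans (time-mono i≤j) (time-step-≤ j)

  time-increases : ∀ i → Acc _<_ (μ i) → ∃ λ j → time i < time j
  time-increases i (acc rs) with lexDescends i
  ... | inj₁ lt        = suc i , lt
  ... | inj₂ (eq , lt) with time-increases (suc i) (rs lt)
  ...   | j , later    = j , subst (_< time j) eq later

  time-unbounded : ∀ N → ∃ λ k → N ≤ time k
  time-unbounded 0       = 0 , z≤n
  time-unbounded (suc N) with time-unbounded N
  ... | k , N≤k with time-increases k (<-wellFounded (μ k))
  ...   | j , k<j      = j , ≤-<-trans N≤k k<j

  time-eventually-≥ : ∀ N → ∃ λ k → ∀ i → k ≤ i → N ≤ time i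
  time-eventually-≥ N with time-unbounded N
  ... | k , N≤k = k , λ i k≤i → ≤-trans N≤k (time-mono (≤⇒≤′ k≤i))

module _ {A : Set} (t : ℕ) where

  #present : List (A × ℕ) → ℕ
  #present xs = length (filter (λ x → proj₂ x ≤? t) xs)

  #present-++ : ∀ xs ys → #present (xs ++ ys) ≡ #present xs + #present ys
  #present-++ xs ys =
    trans (cong length (filter-++ (λ x → proj₂ x ≤? t) xs ys)) (length-++ (filter _ xs))

  #present-split : ∀ {xs} ys zs rest → xs ↭ (ys ++ zs) ++ rest →
                   #present xs ≡ (#present ys + #present zs) + #present rest
  #present-split ys zs rest xs↭ = trans (↭-length (filter-↭ _ xs↭))
    (trans (#present-++ (ys ++ zs) rest) (cong (_+ #present rest) (#present-++ ys zs)))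

  #present-all : ∀ {xs} → All (λ x → proj₂ x ≤ t) xs → #present xs ≡ length xs
  #present-all all≤ = cong length (filter-all _ all≤)

  #present-future : ∀ {xs} → Any (λ x → t < proj₂ x) xs → #present xs < length xs
  #present-future {xs} future = filter-notAll _ xs (Any.map <⇒≱ future)

sat-cge-0 : ∀ τ a b sg → sat τ (cge a b sg 0) → τ b ≤ τ a
sat-cge-0 τ a b plus  (inj₁ b+0<a) = m+n≤o⇒m≤o (τ b) (<⇒≤ b+0<a)
sat-cge-0 τ a b plus  (inj₂ a≡b+0) = m+n≤o⇒m≤o (τ b) (≤-reflexive (sym a≡b+0))
sat-cge-0 τ a b minus (inj₁ b<a+0) = ≤-trans (<⇒≤ b<a+0) (≤-reflexive (+-identityʳ (τ a)))
sat-cge-0 τ a b minus (inj₂ a+0≡b) = ≤-trans (≤-reflexive (sym a+0≡b)) (≤-reflexive (+-identityʳ (τ a)))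

module _ {𝔄 : Alphabet} where

  consumed-not-future : ∀ (r : InstRule 𝔄) τ →
    All (λ f → ∃ λ sg → cge (T r) (proj₂ f) sg 0 ∈ guard r) (F r) →
    All (sat τ) (guard r) → All (λ f → τ (proj₂ f) ≤ τ (T r)) (F r)
  consumed-not-future r τ bounds holds =
    All.map (λ { (sg , c∈guard) → sat-cge-0 τ (T r) _ sg (All.lookup holds c∈guard) }) bounds

  #present-instF : ∀ (σ : Subst 𝔄) τ t fs → All (λ f → τ (proj₂ f) ≤ t) fs →
                   #present t (instF σ τ fs) ≡ length fs
  #present-instF σ τ t fs not-future = trans (#present-all t (All.map⁺ not-future)) (length-map _ fs)

  #present-instQ : ∀ (σ : Subst 𝔄) t qs → Any (λ q → 1 ≤ proj₂ q) qs →
                   #present t (instQ σ t qs) < length qs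
  #present-instQ σ t qs delayed =
    <-≤-trans (#present-future t (Any.map⁺ (Any.map (m<m+n t) delayed)))
              (≤-reflexive (length-map _ qs))

  #presentFacts : Config 𝔄 → ℕ
  #presentFacts c = #present (Config.time c) (Config.facts c)

  Step-lexDescends : ∀ {R} → PTS R → ∀ {c c'} → Step R c c' →
    Config.time c < Config.time c' ⊎
    (Config.time c' ≡ Config.time c × #presentFacts c' < #presentFacts c)
  Step-lexDescends pts (tick t fs) = inj₁ (n<1+n t)
  Step-lexDescends pts (inst r r∈R σ τ rest _ fs fs' refl holds fs↭ fs'↭) =
    inj₂ (refl , fewer-present)
    where
      open ≤-Reasoning
      t = τ (T r)
      iW = instW σ τ (W r)
      iF = instF σ τ (F r)
      iQ = instQ σ t (Q r)
      c = #present t rest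
      balanced = proj₁ (pts r r∈R)
      delayed = proj₁ (proj₂ (pts r r∈R))
      consumed : #present t iF ≡ length (F r)
      consumed = #present-instF σ τ t (F r)
        (consumed-not-future r τ (proj₂ (proj₂ (pts r r∈R))) holds)
      fewer-present : #present t fs' < #present t fs
      fewer-present = begin-strict
          #present t fs'                       ≡⟨ #present-split t iW iQ rest fs'↭ ⟩
          (#present t iW + #present t iQ) + c  <⟨ +-monoˡ-< c (+-monoʳ-< (#present t iW) (#present-instQ σ t (Q r) delayed)) ⟩
          (#present t iW + length (Q r)) + c   ≡⟨ cong (λ n → (#present t iW + n) + c) (sym balanced) ⟩
          (#present t iW + length (F r)) + c   ≡⟨ cong (λ n → (#present t iW + n) + c) (sym consumed) ⟩
          (#present t iW + #present t iF) + c  ≡⟨ sym (#present-split t iW iF rest fs↭) ⟩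
          #present t fs                        ∎

proposition3 : (𝔄 : Alphabet) (R : InstRule 𝔄 → Set) → PTS R →
               (s : ℕ → Config 𝔄) → InfTrace R s →
               ∀ (N : ℕ) → ∃ λ (k : ℕ) → ∀ (i : ℕ) → k ≤ i → N ≤ Config.time (s i)
proposition3 𝔄 R pts s trace =
  time-eventually-≥ (λ i → Config.time (s i)) (λ i → #presentFacts (s i))
                    (λ i → Step-lexDescends pts (trace i))
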